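{- For $a\in\{0,1\}$ and $\ell\ge2$, the cycle of the permutation $S_a(a^\ell)$ of $\{0,1\}^\ell$ containing $0^{\ell-1}1$ contains an odd number of words whose first letter is $1$ if and only if $\ell$ is a power of $2$.
   Context: For words $w=w_1\cdots w_\ell$, $u=u_1\cdots u_\ell$ over $\{0,1\}$ and $a\in\{0,1\}$, $S_a(w)(u)\in\{0,1\}^\ell$ is the word with $\ell$-th letter $u_\ell$ and $i$-th letter $u_i\oplus(u_{i+1}\wedge[w_{i+1}=a])$ for $1\le i\le\ell-1$ ($[\cdot]$ the indicator; $\oplus,\wedge$ XOR/AND); it is a bijection of $\{0,1\}^\ell$. $a^\ell$ is the word of $\ell$ copies of $a$; the cycle containing $u$ is $\{S_a(w)^m(u):m\ge0\}$. -}

module Defs where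

open import Data.Bool using (Bool; true; false; _∧_; _xor_; if_then_else_)
open import Data.Bool.Properties using (_≟_)
open import Data.Nat using (ℕ; zero; suc; _^_; _*_)
open import Data.Vec using (Vec; []; _∷_; replicate; head)
open import Data.List using (List; length)
open import Data.List.Membership.Propositional using (_∈_)
open import Data.List.Relation.Unary.Unique.Propositional using (Unique)
open import Data.Product using (Σ; ∃; _×_)
open import Function using (_⇔_)
open import Relation.Nullary.Decidable using (⌊_⌋)
open import Relation.Binary.PropositionalEquality using (_≡_)

-- Words over {0,1} of length ℓ: Vec Bool ℓ, with 0 = false, 1 = true.

eqB : Bool → Bool → Bool
eqB x a = ⌊ x ≟ a ⌋

S : (a : Bool) → ∀ {ℓ} → Vec Bool ℓ → Vec Bool ℓ → Vec Bool ℓ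
S a [] [] = []
S a (w₁ ∷ []) (u₁ ∷ []) = u₁ ∷ []
S a (w₁ ∷ w₂ ∷ ws) (u₁ ∷ u₂ ∷ us) =
  (u₁ xor (u₂ ∧ eqB w₂ a)) ∷ S a (w₂ ∷ ws) (u₂ ∷ us)

iter : ∀ {A : Set} → (A → A) → ℕ → A → A
iter f zero x = x
iter f (suc m) x = f (iter f m x)

InCycle : (a : Bool) → ∀ {ℓ} → (w u v : Vec Bool ℓ) → Set
InCycle a w u v = ∃ λ m → iter (S a w) m u ≡ v

zerosOne : (n : ℕ) → Vec Bool (suc n)
zerosOne zero = true ∷ []
zerosOne (suc n) = false ∷ zerosOne n

FirstIs1 : ∀ {n} → Vec Bool (suc n) → Set
FirstIs1 v = head v ≡ true

CountFirst1InCycle : (a : Bool) → ∀ {n} → (w u : Vec Bool (suc n)) → ℕ → Set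
CountFirst1InCycle a w u k =
  Σ (List (Vec Bool _)) λ xs →
    Unique xs × (∀ v → (v ∈ xs ⇔ (InCycle a w u v × FirstIs1 v))) × length xs ≡ k

Odd : ℕ → Set
Odd k = ∃ λ j → k ≡ suc (2 * j)

IsPowerOf2 : ℕ → Set
IsPowerOf2 ℓ = ∃ λ k → ℓ ≡ 2 ^ k

-- Read a word of length ℓ as a polynomial over 𝔽₂ of degree < ℓ, its i-th letter being the
-- coefficient of x^(ℓ-i). Then S_a(a^ℓ) is multiplication by 1 + x modulo x^ℓ and 0^(ℓ-1)1 is 1,
-- so the cycle consists of the truncations of the powers (1+x)^m, and the first letter of the
-- m-th one is C(m, ℓ-1) mod 2. In characteristic 2, (1+x)^(2^j) = 1 + x^(2^j). Take
-- 2^J < ℓ ≤ 2^(J+1) = P. Then the cycle has length exactly P, since for 0 < d < P the leading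
-- binary digit 2^j of d gives a nonzero coefficient of (1+x)^d with degree < ℓ. Pascal's rule
-- gives Σ_{m<P} C(m, ℓ-1) ≡ C(P, ℓ) (mod 2), and C(P, ℓ) is odd iff ℓ = P.
module Submission where

open import Defs
open import Data.Bool as Bool using (Bool; true; false; _xor_; not; _∧_)
open import Data.Bool.Properties
  using (xor-identityʳ; xor-assoc; xor-same; xor-comm; true-xor; ∧-identityʳ; not-involutive)
open import Data.Fin using (Fin; zero; suc)
open import Data.Fin.Properties using (injective⇒≤)
open import Data.List as List using (List; _∷_; length; filter; applyDownFrom)
open import Data.List.Membership.Propositional using (_∈_)
open import Data.List.Membership.Propositional.Properties
  using (∈-lookup; ∈-filter⁺; ∈-filter⁻; ∈-applyDownFrom⁺; ∈-applyDownFrom⁻)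
open import Data.List.Relation.Binary.Subset.Propositional using (_⊆_)
open import Data.List.Relation.Unary.All as All using ()
open import Data.List.Relation.Unary.AllPairs using (_∷_)
open import Data.List.Relation.Unary.Any using (index)
open import Data.List.Relation.Unary.Any.Properties using (lookup-index)
open import Data.List.Relation.Unary.Unique.Propositional using (Unique)
open import Data.List.Relation.Unary.Unique.Propositional.Properties using (filter⁺; applyDownFrom⁺₁)
open import Data.Nat
open import Data.Nat.DivMod using (_%_; _/_; m≡m%n+[m/n]*n; m%n<n)
open import Data.Nat.Properties
open import Data.Product using (∃; _×_; _,_)
open import Data.Sum using (_⊎_; inj₁; inj₂)
open import Data.Vec using (Vec; []; _∷_; replicate; head)
open import Data.Vec.Properties using (∷-injectiveˡ; ∷-injectiveʳ)
open import Function using (_∘_; _⇔_; mk⇔; Equivalence)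
open import Function.Construct.Composition using (_⇔-∘_)
open import Function.Construct.Symmetry using (⇔-sym)
open import Function.Definitions using (Injective)
open import Relation.Binary.PropositionalEquality
open import Relation.Nullary using (contradiction)
open import Relation.Unary using (Decidable)

xor-cancel-middle : ∀ a b c → (a xor b) xor (b xor c) ≡ a xor c
xor-cancel-middle a b c = begin
  (a xor b) xor (b xor c) ≡⟨ xor-assoc a b (b xor c) ⟩
  a xor (b xor (b xor c)) ≡⟨ cong (a xor_) (xor-assoc b b c) ⟨
  a xor ((b xor b) xor c) ≡⟨ cong (λ z → a xor (z xor c)) (xor-same b) ⟩
  a xor c                 ∎
  where open ≡-Reasoning

xor-cancelʳ : ∀ c {a b} → a xor c ≡ b xor c → a ≡ b
xor-cancelʳ c {a} {b} eq = begin
  a               ≡⟨ xor-xor-cancelʳ a ⟨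
  (a xor c) xor c ≡⟨ cong (_xor c) eq ⟩
  (b xor c) xor c ≡⟨ xor-xor-cancelʳ b ⟩
  b               ∎
  where
  open ≡-Reasoning
  xor-xor-cancelʳ : ∀ x → (x xor c) xor c ≡ x
  xor-xor-cancelʳ x = trans (xor-assoc x c c) (trans (cong (x xor_) (xor-same c)) (xor-identityʳ x))

module _ {A : Set} where

  iter-+ : ∀ (f : A → A) m n x → iter f (m + n) x ≡ iter f m (iter f n x)
  iter-+ f zero    n x = refl
  iter-+ f (suc m) n x = cong f (iter-+ f m n x)

  iter-periodic : ∀ (f : A → A) {p x} → iter f p x ≡ x → ∀ q → iter f (q * p) x ≡ x
  iter-periodic f         fᵖx≡x zero    = refl
  iter-periodic f {p} {x} fᵖx≡x (suc q) =
    trans (iter-+ f p (q * p) x) (trans (cong (iter f p) (iter-periodic f fᵖx≡x q)) fᵖx≡x)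

  iter-injective : ∀ {f : A → A} → Injective _≡_ _≡_ f → ∀ m → Injective _≡_ _≡_ (iter f m)
  iter-injective f-inj zero    eq = eq
  iter-injective f-inj (suc m) eq = iter-injective f-inj m (f-inj eq)

  iter-cong : ∀ {B : Set} {f : (A → B) → A → B} → (∀ {g h} → g ≗ h → f g ≗ f h) →
              ∀ m {g h} → g ≗ h → iter f m g ≗ iter f m h
  iter-cong f-cong zero    g≗h = g≗h
  iter-cong f-cong (suc m) g≗h = f-cong (iter-cong f-cong m g≗h)

binaryMagnitude : ∀ d → 0 < d → ∃ λ j → 2 ^ j ≤ d × d < 2 ^ suc j
binaryMagnitude (suc zero)    _ = 0 , ≤-refl , s≤s (s≤s z≤n)
binaryMagnitude (suc (suc d)) _ with binaryMagnitude (suc d) z<s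
... | j , 2^j≤1+d , 1+d<2^1+j with m≤n⇒m<n∨m≡n 1+d<2^1+j
...   | inj₁ 2+d<2^1+j = j , m≤n⇒m≤1+n 2^j≤1+d , 2+d<2^1+j
...   | inj₂ 2+d≡2^1+j = suc j , ≤-reflexive (sym 2+d≡2^1+j) ,
        subst (λ m → 2 + d < 2 * m) 2+d≡2^1+j (m<m+n (2 + d) z<s)

2^-cancel-< : ∀ {i j} → 2 ^ i < 2 ^ j → i < j
2^-cancel-< 2^i<2^j = ≰⇒> (λ j≤i → <⇒≱ 2^i<2^j (^-monoʳ-≤ 2 j≤i))

Series : Set
Series = ℕ → Bool

one : Series
one zero    = true
one (suc i) = false

infixl 6 _⊕_
infixr 7 x^_*_ [1+x^_]*_

_⊕_ : Series → Series → Series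
(g ⊕ h) i = g i xor h i

x^_*_ : ℕ → Series → Series
(x^ zero  * g) i       = g i
(x^ suc k * g) zero    = false
(x^ suc k * g) (suc i) = (x^ k * g) i

[1+x^_]*_ : ℕ → Series → Series
[1+x^ k ]* g = g ⊕ x^ k * g

[1+x]^_ : ℕ → Series
[1+x]^ m = iter [1+x^ 1 ]*_ m one

x^-*-cong : ∀ k {g h} → g ≗ h → x^ k * g ≗ x^ k * h
x^-*-cong zero    g≗h i       = g≗h i
x^-*-cong (suc k) g≗h zero    = refl
x^-*-cong (suc k) g≗h (suc i) = x^-*-cong k g≗h i

x^-*-⊕ : ∀ k g h → x^ k * (g ⊕ h) ≗ x^ k * g ⊕ x^ k * h
x^-*-⊕ zero    g h i       = refl
x^-*-⊕ (suc k) g h zero    = refl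
x^-*-⊕ (suc k) g h (suc i) = x^-*-⊕ k g h i

x^-*-x^-* : ∀ j k g → x^ j * x^ k * g ≗ x^ (j + k) * g
x^-*-x^-* zero    k g i       = refl
x^-*-x^-* (suc j) k g zero    = refl
x^-*-x^-* (suc j) k g (suc i) = x^-*-x^-* j k g i

x^-*-coeff-< : ∀ k g {i} → i < k → (x^ k * g) i ≡ false
x^-*-coeff-< (suc k) g {zero}  _         = refl
x^-*-coeff-< (suc k) g {suc i} (s≤s i<k) = x^-*-coeff-< k g i<k

x^-*-coeff-k : ∀ k g → (x^ k * g) k ≡ g 0
x^-*-coeff-k zero    g = refl
x^-*-coeff-k (suc k) g = x^-*-coeff-k k g

x^-*-one-coeff : ∀ k i → (x^ k * one) i ≡ true ⇔ i ≡ k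
x^-*-one-coeff zero    zero    = mk⇔ (λ _ → refl) (λ _ → refl)
x^-*-one-coeff zero    (suc i) = mk⇔ (λ ()) (λ ())
x^-*-one-coeff (suc k) zero    = mk⇔ (λ ()) (λ ())
x^-*-one-coeff (suc k) (suc i) =
  mk⇔ (cong suc ∘ Equivalence.to (x^-*-one-coeff k i))
      (Equivalence.from (x^-*-one-coeff k i) ∘ suc-injective)

[1+x^]-*-cong : ∀ k {g h} → g ≗ h → [1+x^ k ]* g ≗ [1+x^ k ]* h
[1+x^]-*-cong k g≗h i = cong₂ _xor_ (g≗h i) (x^-*-cong k g≗h i)

[1+x^k]²≗1+x^2k : ∀ k g → [1+x^ k ]* [1+x^ k ]* g ≗ [1+x^ (k + k) ]* g
[1+x^k]²≗1+x^2k k g i = begin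
  (g i xor (x^ k * g) i) xor (x^ k * (g ⊕ x^ k * g)) i
    ≡⟨ cong ((g i xor (x^ k * g) i) xor_) (x^-*-⊕ k g (x^ k * g) i) ⟩
  (g i xor (x^ k * g) i) xor ((x^ k * g) i xor (x^ k * x^ k * g) i)
    ≡⟨ xor-cancel-middle (g i) ((x^ k * g) i) _ ⟩
  g i xor (x^ k * x^ k * g) i
    ≡⟨ cong (g i xor_) (x^-*-x^-* k k g i) ⟩
  g i xor (x^ (k + k) * g) i ∎
  where open ≡-Reasoning

[1+x]^2^j≗1+x^2^j : ∀ j g → iter [1+x^ 1 ]*_ (2 ^ j) g ≗ [1+x^ (2 ^ j) ]* g
[1+x]^2^j≗1+x^2^j zero    g i = refl
[1+x]^2^j≗1+x^2^j (suc j) g i rewrite +-identityʳ (2 ^ j) = begin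
  iter [1+x^ 1 ]*_ (p + p) g i                 ≡⟨ cong (λ h → h i) (iter-+ [1+x^ 1 ]*_ p p g) ⟩
  iter [1+x^ 1 ]*_ p (iter [1+x^ 1 ]*_ p g) i  ≡⟨ iter-cong ([1+x^]-*-cong 1) p ([1+x]^2^j≗1+x^2^j j g) i ⟩
  iter [1+x^ 1 ]*_ p ([1+x^ p ]* g) i          ≡⟨ [1+x]^2^j≗1+x^2^j j ([1+x^ p ]* g) i ⟩
  ([1+x^ p ]* [1+x^ p ]* g) i                  ≡⟨ [1+x^k]²≗1+x^2k p g i ⟩
  ([1+x^ (p + p) ]* g) i                       ∎
  where
  open ≡-Reasoning
  p = 2 ^ j

[1+x]^-coeff-0 : ∀ m → ([1+x]^ m) 0 ≡ true
[1+x]^-coeff-0 zero    = refl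
[1+x]^-coeff-0 (suc m) = trans (xor-identityʳ _) ([1+x]^-coeff-0 m)

[1+x]^-coeff-> : ∀ {m i} → m < i → ([1+x]^ m) i ≡ false
[1+x]^-coeff-> {zero}  {suc i} _         = refl
[1+x]^-coeff-> {suc m} {suc i} (s≤s m<i) =
  cong₂ _xor_ ([1+x]^-coeff-> (m<n⇒m<1+n m<i)) ([1+x]^-coeff-> m<i)

[1+x]^-coeff-2^j : ∀ j {d} → 2 ^ j ≤ d → d < 2 ^ suc j → ([1+x]^ d) (2 ^ j) ≡ true
[1+x]^-coeff-2^j j 2^j≤d d<2^1+j with e , refl ← m≤n⇒∃[o]m+o≡n 2^j≤d = begin
  ([1+x]^ (2 ^ j + e)) (2 ^ j)
    ≡⟨ cong (λ h → h (2 ^ j)) (iter-+ [1+x^ 1 ]*_ (2 ^ j) e one) ⟩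
  iter [1+x^ 1 ]*_ (2 ^ j) ([1+x]^ e) (2 ^ j)
    ≡⟨ [1+x]^2^j≗1+x^2^j j ([1+x]^ e) (2 ^ j) ⟩
  ([1+x]^ e) (2 ^ j) xor (x^ (2 ^ j) * [1+x]^ e) (2 ^ j)
    ≡⟨ cong₂ _xor_ ([1+x]^-coeff-> e<2^j) (x^-*-coeff-k (2 ^ j) ([1+x]^ e)) ⟩
  false xor ([1+x]^ e) 0
    ≡⟨ [1+x]^-coeff-0 e ⟩
  true ∎
  where
  open ≡-Reasoning
  e<2^j : e < 2 ^ j
  e<2^j = +-cancelˡ-< (2 ^ j) e (2 ^ j) (subst (2 ^ j + e <_) (cong (2 ^ j +_) (+-identityʳ (2 ^ j))) d<2^1+j)

word : ∀ ℓ → Series → Vec Bool ℓ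
word zero    g = []
word (suc ℓ) g = g ℓ ∷ word ℓ g

word-cong : ∀ ℓ {g h} → (∀ {i} → i < ℓ → g i ≡ h i) → word ℓ g ≡ word ℓ h
word-cong zero    g≡h = refl
word-cong (suc ℓ) g≡h = cong₂ _∷_ (g≡h ≤-refl) (word-cong ℓ (g≡h ∘ m<n⇒m<1+n))

word-injective : ∀ ℓ {g h} → word ℓ g ≡ word ℓ h → ∀ {i} → i < ℓ → g i ≡ h i
word-injective (suc ℓ) eq i<1+ℓ with m≤n⇒m<n∨m≡n (≤-pred i<1+ℓ)
... | inj₁ i<ℓ  = word-injective ℓ (∷-injectiveʳ eq) i<ℓ
... | inj₂ refl = ∷-injectiveˡ eq

zerosOne≡word-one : ∀ n → zerosOne n ≡ word (suc n) one
zerosOne≡word-one zero    = refl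
zerosOne≡word-one (suc n) = cong (false ∷_) (zerosOne≡word-one n)

eqB-refl : ∀ a → eqB a a ≡ true
eqB-refl false = refl
eqB-refl true  = refl

S-aℓ-word : ∀ a n g → S a (replicate (suc n) a) (word (suc n) g) ≡ word (suc n) ([1+x^ 1 ]* g)
S-aℓ-word a zero    g = cong (_∷ []) (sym (xor-identityʳ (g 0)))
S-aℓ-word a (suc n) g rewrite eqB-refl a | ∧-identityʳ (g n) = cong (_ ∷_) (S-aℓ-word a n g)

iter-S-aℓ-zerosOne : ∀ a n m → iter (S a (replicate (suc n) a)) m (zerosOne n) ≡ word (suc n) ([1+x]^ m)
iter-S-aℓ-zerosOne a n zero    = zerosOne≡word-one n
iter-S-aℓ-zerosOne a n (suc m) =
  trans (cong (S a (replicate (suc n) a)) (iter-S-aℓ-zerosOne a n m)) (S-aℓ-word a n ([1+x]^ m))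

S-injective : ∀ a {ℓ} (w : Vec Bool ℓ) → Injective _≡_ _≡_ (S a w)
S-injective a []             {[]}           {[]}           eq = refl
S-injective a (w₁ ∷ [])      {u₁ ∷ []}      {v₁ ∷ []}      eq = eq
S-injective a (w₁ ∷ w₂ ∷ ws) {u₁ ∷ u₂ ∷ us} {v₁ ∷ v₂ ∷ vs} eq
  with refl ← S-injective a (w₂ ∷ ws) (∷-injectiveʳ eq)
  = cong (_∷ u₂ ∷ us) (xor-cancelʳ (u₂ ∧ eqB w₂ a) (∷-injectiveˡ eq))

module _ {A : Set} where

  lookup-injective : ∀ {xs : List A} → Unique xs → Injective _≡_ _≡_ (List.lookup xs)
  lookup-injective (_    ∷ _)   {zero}  {zero}  _  = refl
  lookup-injective (x∉xs ∷ _)   {zero}  {suc j} eq = contradiction eq (All.lookup x∉xs (∈-lookup j))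
  lookup-injective (x∉xs ∷ _)   {suc i} {zero}  eq = contradiction (sym eq) (All.lookup x∉xs (∈-lookup i))
  lookup-injective (_    ∷ uxs) {suc i} {suc j} eq = cong suc (lookup-injective uxs eq)

  Unique⇒length-≤ : ∀ {xs ys : List A} → Unique xs → xs ⊆ ys → length xs ≤ length ys
  Unique⇒length-≤ {xs} {ys} uxs xs⊆ys = injective⇒≤ position-injective
    where
    position : Fin (length xs) → Fin (length ys)
    position i = index (xs⊆ys (∈-lookup i))
    position-injective : Injective _≡_ _≡_ position
    position-injective {i} {j} eq = lookup-injective uxs (begin
      List.lookup xs i            ≡⟨ lookup-index (xs⊆ys (∈-lookup i)) ⟩
      List.lookup ys (position i) ≡⟨ cong (List.lookup ys) eq ⟩
      List.lookup ys (position j) ≡⟨ lookup-index (xs⊆ys (∈-lookup j)) ⟨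
      List.lookup xs j            ∎)
      where open ≡-Reasoning

  Unique-same-elements⇒length-≡ : ∀ {xs ys : List A} → Unique xs → Unique ys →
                                  (∀ v → v ∈ xs ⇔ v ∈ ys) → length xs ≡ length ys
  Unique-same-elements⇒length-≡ uxs uys xs≈ys = ≤-antisym
    (Unique⇒length-≤ uxs (Equivalence.to (xs≈ys _)))
    (Unique⇒length-≤ uys (Equivalence.from (xs≈ys _)))

isOdd : ℕ → Bool
isOdd zero    = false
isOdd (suc k) = not (isOdd k)

isOdd-2* : ∀ j → isOdd (2 * j) ≡ false
isOdd-2* zero    = refl
isOdd-2* (suc j) = trans (cong isOdd (*-suc 2 j)) (trans (not-involutive _) (isOdd-2* j))

even⊎odd : ∀ k → (∃ λ j → k ≡ 2 * j) ⊎ Odd k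
even⊎odd zero = inj₁ (0 , refl)
even⊎odd (suc k) with even⊎odd k
... | inj₁ (j , refl) = inj₂ (j , refl)
... | inj₂ (j , refl) = inj₁ (suc j , sym (*-suc 2 j))

Odd⇔isOdd : ∀ k → Odd k ⇔ isOdd k ≡ true
Odd⇔isOdd k = mk⇔ to from
  where
  to : Odd k → isOdd k ≡ true
  to (j , refl) = cong not (isOdd-2* j)
  from : isOdd k ≡ true → Odd k
  from isOdd[k] with even⊎odd k
  ... | inj₁ (j , refl) = contradiction (trans (sym isOdd[k]) (isOdd-2* j)) λ ()
  ... | inj₂ odd        = odd

firstIs1? : ∀ {n} → Decidable (FirstIs1 {n})
firstIs1? v = head v Bool.≟ true

isOdd-length-filter-firstIs1-∷ : ∀ {n} (v : Vec Bool (suc n)) vs →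
  isOdd (length (filter firstIs1? (v ∷ vs))) ≡ isOdd (length (filter firstIs1? vs)) xor head v
isOdd-length-filter-firstIs1-∷ (true  ∷ _) vs = sym (trans (xor-comm _ true) (true-xor _))
isOdd-length-filter-firstIs1-∷ (false ∷ _) vs = sym (xor-identityʳ _)

module Cycle (a : Bool) (n J : ℕ) (2^J≤n : 2 ^ J ≤ n) (n<2^1+J : n < 2 ^ suc J) where

  P : ℕ
  P = 2 ^ suc J

  instance
    P≢0 : NonZero P
    P≢0 = m^n≢0 2 (suc J)

  T : Vec Bool (suc n) → Vec Bool (suc n)
  T = S a (replicate (suc n) a)

  orbit : ℕ → Vec Bool (suc n)
  orbit m = iter T m (zerosOne n)

  InOrbit : Vec Bool (suc n) → Set
  InOrbit = InCycle a (replicate (suc n) a) (zerosOne n)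

  Count : ℕ → Set
  Count = CountFirst1InCycle a (replicate (suc n) a) (zerosOne n)

  orbit≡word : ∀ m → orbit m ≡ word (suc n) ([1+x]^ m)
  orbit≡word = iter-S-aℓ-zerosOne a n

  head-orbit : ∀ m → head (orbit m) ≡ ([1+x]^ m) n
  head-orbit m = cong head (orbit≡word m)

  orbit-P : orbit P ≡ orbit 0
  orbit-P = begin
    orbit P                 ≡⟨ orbit≡word P ⟩
    word (suc n) ([1+x]^ P) ≡⟨ word-cong (suc n) [1+x]^P≡1 ⟩
    word (suc n) one        ≡⟨ zerosOne≡word-one n ⟨
    orbit 0                 ∎
    where
    open ≡-Reasoning
    [1+x]^P≡1 : ∀ {i} → i < suc n → ([1+x]^ P) i ≡ one i
    [1+x]^P≡1 {i} i≤n = begin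
      ([1+x]^ P) i             ≡⟨ [1+x]^2^j≗1+x^2^j (suc J) one i ⟩
      one i xor (x^ P * one) i ≡⟨ cong (one i xor_) (x^-*-coeff-< P one i<P) ⟩
      one i xor false          ≡⟨ xor-identityʳ (one i) ⟩
      one i                    ∎
      where i<P = ≤-<-trans (≤-pred i≤n) n<2^1+J

  orbit-mod : ∀ m → orbit m ≡ orbit (m % P)
  orbit-mod m = begin
    orbit m                                       ≡⟨ cong orbit (m≡m%n+[m/n]*n m P) ⟩
    orbit (m % P + m / P * P)                     ≡⟨ iter-+ T (m % P) (m / P * P) (zerosOne n) ⟩
    iter T (m % P) (iter T (m / P * P) (orbit 0))
      ≡⟨ cong (iter T (m % P)) (iter-periodic T orbit-P (m / P)) ⟩
    orbit (m % P)                                 ∎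
    where open ≡-Reasoning

  orbit-≢-0 : ∀ {d} → 0 < d → d < P → orbit d ≢ orbit 0
  orbit-≢-0 {d} 0<d d<P orbit[d]≡orbit[0] with j , 2^j≤d , d<2^1+j ← binaryMagnitude d 0<d =
    contradiction (Equivalence.to (x^-*-one-coeff 0 (2 ^ j))
                                  (trans (sym coeff-equal) ([1+x]^-coeff-2^j j 2^j≤d d<2^1+j)))
                  (n>0⇒n≢0 (m^n>0 2 j))
    where
    2^j≤n : 2 ^ j ≤ n
    2^j≤n = ≤-trans (^-monoʳ-≤ 2 (≤-pred (2^-cancel-< {j} {suc J} (≤-<-trans 2^j≤d d<P)))) 2^J≤n
    coeff-equal : ([1+x]^ d) (2 ^ j) ≡ one (2 ^ j)
    coeff-equal = word-injective (suc n)
      (trans (sym (orbit≡word d)) (trans orbit[d]≡orbit[0] (orbit≡word 0))) (s≤s 2^j≤n)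

  orbit-injective : ∀ {r r′} → r < r′ → r′ < P → orbit r′ ≢ orbit r
  orbit-injective {r} r<r′ r′<P orbit[r′]≡orbit[r] with e , refl ← m≤n⇒∃[o]m+o≡n r<r′ =
    orbit-≢-0 z<s (≤-<-trans (s≤s (m≤n+m e r)) r′<P) (iter-injective (S-injective a _) r (begin
      iter T r (orbit (suc e)) ≡⟨ iter-+ T r (suc e) (zerosOne n) ⟨
      orbit (r + suc e)        ≡⟨ cong orbit (+-suc r e) ⟩
      orbit (suc r + e)        ≡⟨ orbit[r′]≡orbit[r] ⟩
      orbit r                  ∎))
    where open ≡-Reasoning

  firstIs1-orbit : ℕ → List (Vec Bool (suc n))
  firstIs1-orbit M = filter firstIs1? (applyDownFrom orbit M)

  firstIs1-orbit-unique : Unique (firstIs1-orbit P)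
  firstIs1-orbit-unique = filter⁺ firstIs1? (applyDownFrom⁺₁ orbit P orbit-injective)

  ∈-firstIs1-orbit : ∀ v → v ∈ firstIs1-orbit P ⇔ (InOrbit v × FirstIs1 v)
  ∈-firstIs1-orbit v = mk⇔ to from
    where
    to : v ∈ firstIs1-orbit P → InOrbit v × FirstIs1 v
    to v∈ with v∈orbits , first1 ← ∈-filter⁻ firstIs1? {xs = applyDownFrom orbit P} v∈
          with m , _ , refl ← ∈-applyDownFrom⁻ orbit v∈orbits = (m , refl) , first1
    from : InOrbit v × FirstIs1 v → v ∈ firstIs1-orbit P
    from ((m , refl) , first1) = ∈-filter⁺ firstIs1?
      (subst (_∈ applyDownFrom orbit P) (sym (orbit-mod m)) (∈-applyDownFrom⁺ orbit (m%n<n m P))) first1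

  isOdd-length-firstIs1-orbit : ∀ M → isOdd (length (firstIs1-orbit M)) ≡ ([1+x]^ M) (suc n)
  isOdd-length-firstIs1-orbit zero    = refl
  isOdd-length-firstIs1-orbit (suc M) = begin
    isOdd (length (firstIs1-orbit (suc M)))
      ≡⟨ isOdd-length-filter-firstIs1-∷ (orbit M) (applyDownFrom orbit M) ⟩
    isOdd (length (firstIs1-orbit M)) xor head (orbit M)
      ≡⟨ cong₂ _xor_ (isOdd-length-firstIs1-orbit M) (head-orbit M) ⟩
    ([1+x]^ M) (suc n) xor ([1+x]^ M) n
      ∎
    where open ≡-Reasoning

  count : Count (length (firstIs1-orbit P))
  count = firstIs1-orbit P , firstIs1-orbit-unique , ∈-firstIs1-orbit , refl

  isOdd-count : ∀ {k} → Count k → isOdd k ≡ (x^ P * one) (suc n)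
  isOdd-count (xs , unique-xs , ∈-xs , refl) = begin
    isOdd (length xs)
      ≡⟨ cong isOdd (Unique-same-elements⇒length-≡ unique-xs firstIs1-orbit-unique
                       (λ v → ⇔-sym (∈-firstIs1-orbit v) ⇔-∘ ∈-xs v)) ⟩
    isOdd (length (firstIs1-orbit P)) ≡⟨ isOdd-length-firstIs1-orbit P ⟩
    ([1+x]^ P) (suc n)                ≡⟨ [1+x]^2^j≗1+x^2^j (suc J) one (suc n) ⟩
    (x^ P * one) (suc n)              ∎
    where open ≡-Reasoning

  odd-count⇔1+n≡P : ∀ {k} → Count k → Odd k ⇔ suc n ≡ P
  odd-count⇔1+n≡P {k} count-k =
    x^-*-one-coeff P (suc n) ⇔-∘ subst (λ b → Odd k ⇔ b ≡ true) (isOdd-count count-k) (Odd⇔isOdd k)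

lemma6p6 : (a : Bool) (n : ℕ) → 2 ≤ suc n →
    ((∃ λ k → CountFirst1InCycle a (replicate (suc n) a) (zerosOne n) k × Odd k)
      ⇔ IsPowerOf2 (suc n))
lemma6p6 a n (s≤s 1≤n) = mk⇔ to from
  where
  to : (∃ λ k → CountFirst1InCycle a (replicate (suc n) a) (zerosOne n) k × Odd k) → IsPowerOf2 (suc n)
  to (k , count-k , odd-k) with J , 2^J≤n , n<2^1+J ← binaryMagnitude n 1≤n =
    suc J , Equivalence.to (Cycle.odd-count⇔1+n≡P a n J 2^J≤n n<2^1+J count-k) odd-k
  from : IsPowerOf2 (suc n) → ∃ λ k → CountFirst1InCycle a (replicate (suc n) a) (zerosOne n) k × Odd k
  from (zero , 1+n≡1)            = contradiction (suc-injective 1+n≡1) (n>0⇒n≢0 1≤n)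
  from (suc J , 1+n≡2^1+J) = _ , count , Equivalence.from (odd-count⇔1+n≡P count) 1+n≡2^1+J
    where
    2^J≤n : 2 ^ J ≤ n
    2^J≤n = ≤-pred (subst (2 ^ J <_) (sym 1+n≡2^1+J) (^-monoʳ-< 2 (s≤s (s≤s z≤n)) (n<1+n J)))
    open Cycle a n J 2^J≤n (≤-reflexive 1+n≡2^1+J)
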